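{- Let $n\ge 3$ and let $\mathbf P=(P_{ij})_{0\le i,j\le n-1}$ be the $n\times n$ transition probability matrix on the states $\{0,1,\dots,n-1\}$ with entries $P_{00}=5/6,\ P_{01}=1/6$; $P_{10}=5/6,\ P_{12}=1/6$; for $2\le i\le n-2$: $P_{i0}=2/3,\ P_{i,i-1}=P_{i,i+1}=1/6$; $P_{n-1,0}=5/6,\ P_{n-1,n-2}=1/6$; and all other entries $0$. Then the steady state probability vector of $\mathbf P$ is $$\vec\pi=\left(\frac{2B_n}{b_{n+1}},\frac{2B_{n-1}}{b_{n+1}},\dots,\frac{2B_1}{b_{n+1}}\right),$$ i.e. $\pi_i=\dfrac{2B_{n-i}}{b_{n+1}}$ for $i=0,1,\dots,n-1$.
   Context: The balancing numbers $B_m$ are defined by $B_0=0$, $B_1=1$, $B_{m+1}=6B_m-B_{m-1}$ (equivalently, the natural numbers $B$ with $8B^2+1$ a perfect square). The cobalancing numbers $b_m$ are defined by $b_0=0$, $b_1=0$, $b_{m+1}=6b_m-b_{m-1}+2$ (so $b_2=2$, $b_3=14,\dots$). The steady state probability vector of a transition probability matrix $\mathbf P$ is the probability row vector $\vec\pi=(\pi_0,\pi_1,\dots)$ (nonnegative entries summing to $1$) satisfying $\vec\pi=\vec\pi\mathbf P$, equivalently $\pi_j=\lim_{m\to\infty}(\mathbf P^m)_{ij}$. -}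

module Defs where

open import Data.Nat as ℕ using (ℕ; zero; suc; _∸_; _≡ᵇ_)
open import Data.Integer using (+_)
open import Data.Fin using (Fin; toℕ) renaming (zero to fz; suc to fs)
open import Data.Bool using (if_then_else_)
open import Data.Rational using (ℚ; 0ℚ; 1ℚ; _/_; _+_; _*_; _≤_)
open import Relation.Binary.PropositionalEquality using (_≡_)
open import Data.Product using (_×_)

-- balancing numbers: B 0 = 0, B 1 = 1, B (m+1) = 6 B m - B (m-1)
-- (truncated subtraction is harmless: the sequence is increasing)
B : ℕ → ℕ
B zero = 0
B (suc zero) = 1
B (suc (suc m)) = 6 ℕ.* B (suc m) ∸ B m

b : ℕ → ℕ
b zero = 0
b (suc zero) = 0
b (suc (suc m)) = (6 ℕ.* b (suc m) ∸ b m) ℕ.+ 2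

-- a / d as a rational; the value for d = 0 is an irrelevant convention
-- (only used with d = b (n+1) > 0)
frac : ℕ → ℕ → ℚ
frac a zero = 0ℚ
frac a (suc d) = (+ a) / suc d

Σ : (n : ℕ) → (Fin n → ℚ) → ℚ
Σ zero f = 0ℚ
Σ (suc n) f = f fz + Σ n (λ i → f (fs i))

Pℕ : ℕ → ℕ → ℕ → ℚ
Pℕ n i j =
  if i ≡ᵇ 0 then
    (if j ≡ᵇ 0 then (+ 5) / 6 else if j ≡ᵇ 1 then (+ 1) / 6 else 0ℚ)
  else if i ≡ᵇ 1 then
    (if j ≡ᵇ 0 then (+ 5) / 6 else if j ≡ᵇ 2 then (+ 1) / 6 else 0ℚ)
  else if i ≡ᵇ (n ∸ 1) then
    (if j ≡ᵇ 0 then (+ 5) / 6 else if j ≡ᵇ (n ∸ 2) then (+ 1) / 6 else 0ℚ)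
  else
    (if j ≡ᵇ 0 then (+ 2) / 3
     else if j ≡ᵇ (i ∸ 1) then (+ 1) / 6
     else if j ≡ᵇ suc i then (+ 1) / 6
     else 0ℚ)

P : (n : ℕ) → Fin n → Fin n → ℚ
P n i j = Pℕ n (toℕ i) (toℕ j)

IsSteadyState : (n : ℕ) → (Fin n → Fin n → ℚ) → (Fin n → ℚ) → Set
IsSteadyState n M π =
  (∀ i → 0ℚ ≤ π i) × (Σ n π ≡ 1ℚ) × (∀ j → π j ≡ Σ n (λ i → π i * M i j))

πexp : (n : ℕ) → Fin n → ℚ
πexp n i = frac (2 ℕ.* B (n ∸ toℕ i)) (b (suc n))

{-# OPTIONS --safe #-}
module Submission where

-- Balancing and cobalancing numbers satisfy the first-order system
-- B (m+1) = 5 B m + 2 b m + 1, b (m+1) = b m + 2 B m, from which the recurrence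
-- B m + B (m+2) = 6 B (m+1), the sum 2 (B 1 + ... + B n) = b (n+1) and the identity
-- 5 B (m+1) = B m + 1 + 2 b (m+2) follow. For j ≥ 1 the j-th column of P has 1/6 in
-- rows j-1 and j+1 only, so π = π P says π(j-1) + π(j+1) = 6 π j, with π n = 0 at
-- the right end: read from the last state backwards this is the balancing recurrence,
-- hence π i = c B (n-i) with c = π (n-1). Normalisation forces c = 2 / b (n+1), and for
-- this c the remaining equation of column 0 is the last identity above.

open import Defs
open import Algebra.Bundles using (CommutativeRing)
open import Data.Bool using (true; false; if_then_else_)
open import Data.Fin using (Fin; toℕ; fromℕ<) renaming (zero to fz; suc to fs)
import Data.Fin.Properties as Finₚ
import Data.Integer as ℤ
import Data.Integer.Properties as ℤₚ
open import Data.Nat as ℕ using (ℕ; zero; suc; pred; _∸_; _≡ᵇ_; _≤_; _<_; z≤n; s≤s)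
import Data.Nat.Properties as ℕₚ
open import Data.Product using (_×_; _,_; proj₁; proj₂)
open import Data.Vec.Functional using (replicate)
open import Function using (_∘_)
open import Relation.Binary.PropositionalEquality
open import Relation.Nullary using (yes; no)
open import Relation.Nullary.Decidable using (dec-true; dec-false)

module _ where
  open import Data.List using (_∷_; [])
  open import Data.Nat using (_+_; _*_)
  open import Data.Nat.Tactic.RingSolver using (solve)

  private
    ∸-from-+ : ∀ {a c d} → a ≡ c + d → a ∸ c ≡ d
    ∸-from-+ {c = c} {d} refl = ℕₚ.m+n∸m≡n c d

    six-next-B : ∀ x y {x′ y′} → x′ ≡ 5 * x + 2 * y + 1 → y′ ≡ y + 2 * x →
      6 * x′ ≡ x + (5 * x′ + 2 * y′ + 1)
    six-next-B x y refl refl = solve (x ∷ y ∷ [])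

    next-b : ∀ x y {x′ y′} → x′ ≡ 5 * x + 2 * y + 1 → y′ ≡ y + 2 * x →
      (6 * y′ ∸ y) + 2 ≡ y′ + 2 * x′
    next-b x y refl refl =
      trans (cong (_+ 2) (∸-from-+ {c = y} {d = 5 * y + 12 * x} (solve (x ∷ y ∷ []))))
            (solve (x ∷ y ∷ []))

  B-suc : ∀ m → B (suc m) ≡ 5 * B m + 2 * b m + 1
  b-suc : ∀ m → b (suc m) ≡ b m + 2 * B m

  B-suc zero    = refl
  B-suc (suc m) = ∸-from-+ {c = B m} (six-next-B (B m) (b m) (B-suc m) (b-suc m))

  b-suc zero    = refl
  b-suc (suc m) = next-b (B m) (b m) (B-suc m) (b-suc m)

  B-rec : ∀ m → B m + B (suc (suc m)) ≡ 6 * B (suc m)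
  B-rec m = trans (cong (B m +_) (B-suc (suc m)))
                  (sym (six-next-B (B m) (b m) (B-suc m) (b-suc m)))

  five-B-suc : ∀ m → 5 * B (suc m) ≡ B m + 1 + 2 * b (suc (suc m))
  five-B-suc m = five-next (B m) (b m) (B-suc m) (b-suc m) (b-suc (suc m))
    where
    five-next : ∀ x y {x′ y′ y″} → x′ ≡ 5 * x + 2 * y + 1 → y′ ≡ y + 2 * x →
      y″ ≡ y′ + 2 * x′ → 5 * x′ ≡ x + 1 + 2 * y″
    five-next x y refl refl refl = solve (x ∷ y ∷ [])

  b-pos : ∀ m → 0 < b (suc (suc m))
  b-pos m = subst (0 <_) (sym (b-suc (suc m)))
    (ℕₚ.<-≤-trans B-pos (ℕₚ.≤-trans (ℕₚ.m≤m+n _ _) (ℕₚ.m≤n+m _ (b (suc m)))))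
    where
    B-pos : 0 < B (suc m)
    B-pos = subst (0 <_) (sym (B-suc m)) (ℕₚ.m≤n+m 1 _)

open import Data.Rational using (ℚ; 0ℚ; 1ℚ; _/_; _+_; _*_; _-_; toℚᵘ)
import Data.Rational as ℚ
open import Data.Rational.Properties
  using ( +-*-commutativeRing; toℚᵘ-injective; toℚᵘ-fromℚᵘ; toℚᵘ-homo-+; toℚᵘ-homo-*
        ; nonNegative⁻¹; normalize-nonNeg; ≤-refl
        ; +-identityˡ; +-identityʳ; *-identityʳ; *-zeroˡ; *-zeroʳ; *-distribˡ-+; *-distribʳ-+ )
open import Data.Rational.Solver using (module +-*-Solver)
import Data.Rational.Unnormalised as ℚᵘ
import Data.Rational.Unnormalised.Properties as ℚᵘₚ
open import Algebra.Properties.Semiring.Sum (CommutativeRing.semiring +-*-commutativeRing)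
  using (sum; sum-syntax; sum-cong-≗; sum-replicate-zero; ∑-distrib-+; *-distribˡ-sum)

open +-*-Solver using (solve; _:+_; _:*_; _:-_; _:=_; con)

fromℕ : ℕ → ℚ
fromℕ a = ℤ.+ a / 1

private
  toℚᵘ-/ : ∀ p d → toℚᵘ (p / suc d) ℚᵘ.≃ ℚᵘ.mkℚᵘ p d
  toℚᵘ-/ p d = toℚᵘ-fromℚᵘ (ℚᵘ.mkℚᵘ p d)

  mkℚᵘ-homo-+ : ∀ p q → ℚᵘ.mkℚᵘ (p ℤ.+ q) 0 ℚᵘ.≃ ℚᵘ.mkℚᵘ p 0 ℚᵘ.+ ℚᵘ.mkℚᵘ q 0
  mkℚᵘ-homo-+ p q =
    ℚᵘ.*≡* (cong (ℤ._* ℤ.1ℤ) (sym (cong₂ ℤ._+_ (ℤₚ.*-identityʳ p) (ℤₚ.*-identityʳ q))))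

fromℕ-homo-+ : ∀ a c → fromℕ (a ℕ.+ c) ≡ fromℕ a + fromℕ c
fromℕ-homo-+ a c = toℚᵘ-injective (begin
  toℚᵘ (fromℕ (a ℕ.+ c))                   ≈⟨ toℚᵘ-/ (ℤ.+ (a ℕ.+ c)) 0 ⟩
  ℚᵘ.mkℚᵘ (ℤ.+ a ℤ.+ ℤ.+ c) 0               ≈⟨ mkℚᵘ-homo-+ (ℤ.+ a) (ℤ.+ c) ⟩
  ℚᵘ.mkℚᵘ (ℤ.+ a) 0 ℚᵘ.+ ℚᵘ.mkℚᵘ (ℤ.+ c) 0   ≈⟨ ℚᵘₚ.+-cong (toℚᵘ-/ (ℤ.+ a) 0) (toℚᵘ-/ (ℤ.+ c) 0) ⟨
  toℚᵘ (fromℕ a) ℚᵘ.+ toℚᵘ (fromℕ c)         ≈⟨ toℚᵘ-homo-+ (fromℕ a) (fromℕ c) ⟨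
  toℚᵘ (fromℕ a + fromℕ c)                 ∎)
  where open ℚᵘₚ.≃-Reasoning

fromℕ-homo-* : ∀ a c → fromℕ (a ℕ.* c) ≡ fromℕ a * fromℕ c
fromℕ-homo-* a c = toℚᵘ-injective (begin
  toℚᵘ (fromℕ (a ℕ.* c))                   ≈⟨ toℚᵘ-/ (ℤ.+ (a ℕ.* c)) 0 ⟩
  ℚᵘ.mkℚᵘ (ℤ.+ (a ℕ.* c)) 0                 ≡⟨ cong (λ p → ℚᵘ.mkℚᵘ p 0) (ℤₚ.pos-* a c) ⟩
  ℚᵘ.mkℚᵘ (ℤ.+ a) 0 ℚᵘ.* ℚᵘ.mkℚᵘ (ℤ.+ c) 0   ≈⟨ ℚᵘₚ.*-cong (toℚᵘ-/ (ℤ.+ a) 0) (toℚᵘ-/ (ℤ.+ c) 0) ⟨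
  toℚᵘ (fromℕ a) ℚᵘ.* toℚᵘ (fromℕ c)         ≈⟨ toℚᵘ-homo-* (fromℕ a) (fromℕ c) ⟨
  toℚᵘ (fromℕ a * fromℕ c)                 ∎)
  where open ℚᵘₚ.≃-Reasoning

frac-fromℕ : ∀ a D → frac a D ≡ fromℕ a * frac 1 D
frac-fromℕ a zero    = sym (*-zeroʳ (fromℕ a))
frac-fromℕ a (suc d) = toℚᵘ-injective (begin
  toℚᵘ (frac a (suc d))                      ≈⟨ toℚᵘ-/ (ℤ.+ a) d ⟩
  ℚᵘ.mkℚᵘ (ℤ.+ a) d                          ≈⟨ ℚᵘ.*≡* (cong₂ ℤ._*_ (sym (ℤₚ.*-identityʳ (ℤ.+ a)))
                                                                  (cong (λ n → ℤ.+ suc n) (ℕₚ.+-identityʳ d))) ⟩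
  ℚᵘ.mkℚᵘ (ℤ.+ a) 0 ℚᵘ.* ℚᵘ.mkℚᵘ ℤ.1ℤ d        ≈⟨ ℚᵘₚ.*-cong (toℚᵘ-/ (ℤ.+ a) 0) (toℚᵘ-/ ℤ.1ℤ d) ⟨
  toℚᵘ (fromℕ a) ℚᵘ.* toℚᵘ (frac 1 (suc d))   ≈⟨ toℚᵘ-homo-* (fromℕ a) (frac 1 (suc d)) ⟨
  toℚᵘ (fromℕ a * frac 1 (suc d))            ∎)
  where open ℚᵘₚ.≃-Reasoning

fromℕ*frac1 : ∀ {D} → 0 < D → fromℕ D * frac 1 D ≡ 1ℚ
fromℕ*frac1 {suc d} _ = begin
  fromℕ (suc d) * frac 1 (suc d)  ≡⟨ frac-fromℕ (suc d) (suc d) ⟨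
  frac (suc d) (suc d)            ≡⟨ toℚᵘ-injective (ℚᵘₚ.≃-trans (toℚᵘ-/ (ℤ.+ suc d) d)
                                                                (ℚᵘ.*≡* (ℤₚ.*-comm (ℤ.+ suc d) ℤ.1ℤ))) ⟩
  1ℚ                              ∎
  where open ≡-Reasoning

frac-nonNegative : ∀ a D → 0ℚ ℚ.≤ frac a D
frac-nonNegative a zero    = ≤-refl
frac-nonNegative a (suc d) = nonNegative⁻¹ (ℤ.+ a / suc d) {{normalize-nonNeg a (suc d)}}

Σ≡sum : ∀ n (f : Fin n → ℚ) → Σ n f ≡ sum f
Σ≡sum zero    f = refl
Σ≡sum (suc n) f = cong (f fz +_) (Σ≡sum n (f ∘ fs))

VanishesFrom : ℕ → (ℕ → ℚ) → Set
VanishesFrom n x = ∀ k → n ≤ k → x k ≡ 0ℚ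

pointMass : ℚ → ℕ → ℕ → ℚ
pointMass c a k = if a ≡ᵇ k then c else 0ℚ

∑-pointMass : ∀ n (x : ℕ → ℚ) c a → VanishesFrom n x →
  ∑[ i < n ] (x (toℕ i) * pointMass c a (toℕ i)) ≡ x a * c
∑-pointMass zero x c a x≡0 = sym (trans (cong (_* c) (x≡0 a z≤n)) (*-zeroˡ c))
∑-pointMass (suc n) x c zero _ = begin
  x 0 * c + ∑[ i < n ] (x (suc (toℕ i)) * 0ℚ)
    ≡⟨ cong (x 0 * c +_) (trans (sum-cong-≗ {y = replicate n 0ℚ} (λ i → *-zeroʳ (x (suc (toℕ i)))))
                                (sum-replicate-zero n)) ⟩
  x 0 * c + 0ℚ
    ≡⟨ +-identityʳ (x 0 * c) ⟩
  x 0 * c ∎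
  where open ≡-Reasoning
∑-pointMass (suc n) x c (suc a) x≡0 = begin
  x 0 * 0ℚ + rest  ≡⟨ cong (_+ rest) (*-zeroʳ (x 0)) ⟩
  0ℚ + rest        ≡⟨ +-identityˡ rest ⟩
  rest             ≡⟨ ∑-pointMass n (x ∘ suc) c a (λ k n≤k → x≡0 (suc k) (s≤s n≤k)) ⟩
  x (suc a) * c    ∎
  where
  open ≡-Reasoning
  rest : ℚ
  rest = ∑[ i < n ] (x (suc (toℕ i)) * pointMass c a (toℕ i))

sixth : ℚ
sixth = ℤ.+ 1 / 6

private
  ≡ᵇ-refl : ∀ n → (n ≡ᵇ n) ≡ true
  ≡ᵇ-refl n = dec-true (n ℕ.≟ n) refl

  ≢⇒≡ᵇ-false : ∀ {m n} → m ≢ n → (m ≡ᵇ n) ≡ false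
  ≢⇒≡ᵇ-false {m} {n} = dec-false (m ℕ.≟ n)

P-column-suc : ∀ m k j → j ≤ suc m →
  Pℕ (3 ℕ.+ m) k (suc j) ≡ pointMass sixth (suc (suc j)) k + pointMass sixth j k
P-column-suc m zero          j _ = sym (+-identityˡ _)
P-column-suc m (suc zero)    j _ = sym (+-identityˡ _)
P-column-suc m (suc (suc k)) j j≤1+m with k ℕ.≟ m
... | yes refl rewrite ≡ᵇ-refl k | ≢⇒≡ᵇ-false (ℕₚ.<⇒≢ (s≤s j≤1+m)) = sym (+-identityʳ _)
... | no k≢m rewrite ≢⇒≡ᵇ-false k≢m with j ℕ.≟ k
...   | yes refl rewrite ≡ᵇ-refl j | ≢⇒≡ᵇ-false (ℕₚ.<⇒≢ (ℕₚ.m<n⇒m<1+n (ℕₚ.n<1+n j)))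
                                     = sym (+-identityʳ _)
...   | no j≢k rewrite ≢⇒≡ᵇ-false j≢k = sym (+-identityˡ _)

P-column-zero : ∀ m k → Pℕ (3 ℕ.+ m) k 0 ≡
  ℤ.+ 2 / 3 + (pointMass sixth 0 k + pointMass sixth 1 k + pointMass sixth (suc (suc m)) k)
P-column-zero m zero       = refl
P-column-zero m (suc zero) = refl
P-column-zero m (suc (suc k)) with k ℕ.≟ m
... | yes refl rewrite ≡ᵇ-refl k = refl
... | no k≢m rewrite ≢⇒≡ᵇ-false k≢m | ≢⇒≡ᵇ-false (k≢m ∘ sym) = refl

timesP : ℕ → (ℕ → ℚ) → ℕ → ℚ
timesP n x j = ∑[ i < n ] (x (toℕ i) * Pℕ n (toℕ i) j)

module _ (m : ℕ) (x : ℕ → ℚ) (x-vanishes : VanishesFrom (3 ℕ.+ m) x) where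
  private
    N : ℕ
    N = 3 ℕ.+ m

    δ : ℕ → Fin N → ℚ
    δ a i = pointMass sixth a (toℕ i)

    xδ : ℕ → Fin N → ℚ
    xδ a i = x (toℕ i) * δ a i

    ∑xδ : ∀ a → ∑[ i < N ] xδ a i ≡ x a * sixth
    ∑xδ a = ∑-pointMass N x sixth a x-vanishes

  timesP-suc : ∀ j → j ≤ suc m → timesP N x (suc j) ≡ x (suc (suc j)) * sixth + x j * sixth
  timesP-suc j j≤1+m = begin
    timesP N x (suc j)
      ≡⟨ sum-cong-≗ (λ i → trans (cong (x (toℕ i) *_) (P-column-suc m (toℕ i) j j≤1+m))
                                (*-distribˡ-+ (x (toℕ i)) (δ (suc (suc j)) i) (δ j i))) ⟩
    ∑[ i < N ] (xδ (suc (suc j)) i + xδ j i)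
      ≡⟨ ∑-distrib-+ (xδ (suc (suc j))) (xδ j) ⟩
    ∑[ i < N ] xδ (suc (suc j)) i + ∑[ i < N ] xδ j i
      ≡⟨ cong₂ _+_ (∑xδ (suc (suc j))) (∑xδ j) ⟩
    x (suc (suc j)) * sixth + x j * sixth ∎
    where open ≡-Reasoning

  timesP-zero : timesP N x 0 ≡
    ℤ.+ 2 / 3 * ∑[ i < N ] x (toℕ i) + (x 0 * sixth + x 1 * sixth + x (suc (suc m)) * sixth)
  timesP-zero = begin
    timesP N x 0
      ≡⟨ sum-cong-≗ (λ i → trans (cong (x (toℕ i) *_) (P-column-zero m (toℕ i)))
                                (expand (x (toℕ i)) (δ 0 i) (δ 1 i) (δ (suc (suc m)) i))) ⟩
    ∑[ i < N ] (⅔x i + (xδ 0 i + xδ 1 i + xδ (suc (suc m)) i))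
      ≡⟨ ∑-distrib-+ ⅔x (λ i → xδ 0 i + xδ 1 i + xδ (suc (suc m)) i) ⟩
    ∑[ i < N ] ⅔x i + ∑[ i < N ] (xδ 0 i + xδ 1 i + xδ (suc (suc m)) i)
      ≡⟨ cong (∑[ i < N ] ⅔x i +_)
              (trans (∑-distrib-+ (λ i → xδ 0 i + xδ 1 i) (xδ (suc (suc m))))
                     (cong (_+ ∑[ i < N ] xδ (suc (suc m)) i) (∑-distrib-+ (xδ 0) (xδ 1)))) ⟩
    ∑[ i < N ] ⅔x i + (∑[ i < N ] xδ 0 i + ∑[ i < N ] xδ 1 i + ∑[ i < N ] xδ (suc (suc m)) i)
      ≡⟨ cong₂ _+_ (sym (*-distribˡ-sum {N} (ℤ.+ 2 / 3) (x ∘ toℕ)))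
                   (cong₂ _+_ (cong₂ _+_ (∑xδ 0) (∑xδ 1)) (∑xδ (suc (suc m)))) ⟩
    ℤ.+ 2 / 3 * ∑[ i < N ] x (toℕ i) + (x 0 * sixth + x 1 * sixth + x (suc (suc m)) * sixth) ∎
    where
    open ≡-Reasoning
    ⅔x : Fin N → ℚ
    ⅔x i = ℤ.+ 2 / 3 * x (toℕ i)
    expand : ∀ y a b c → y * (ℤ.+ 2 / 3 + (a + b + c)) ≡ ℤ.+ 2 / 3 * y + (y * a + y * b + y * c)
    expand = solve 4 (λ y a b c → y :* (con (ℤ.+ 2 / 3) :+ (a :+ b :+ c))
                               := con (ℤ.+ 2 / 3) :* y :+ (y :* a :+ y :* b :+ y :* c)) refl

Bᴿ : ℕ → ℕ → ℚ
Bᴿ n k = fromℕ (B (n ∸ k))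

BalancingRecurrence : ℕ → (ℕ → ℚ) → Set
BalancingRecurrence n y =
  ∀ j → suc (suc j) ≤ n → y (suc j) ≡ y (suc (suc j)) * sixth + y j * sixth

private
  solve-last : ∀ {a} p q → a ≡ p * sixth + q * sixth → q ≡ fromℕ 6 * a - p
  solve-last p q refl =
    solve 2 (λ p q → q := con (fromℕ 6) :* (p :* con sixth :+ q :* con sixth) :- p) refl p q

fromℕ-B-rec : ∀ t → fromℕ (B (suc t)) ≡ fromℕ (B t) * sixth + fromℕ (B (suc (suc t))) * sixth
fromℕ-B-rec t = begin
  β₁                       ≡⟨ solve 1 (λ b → b := con (fromℕ 6) :* b :* con sixth) refl β₁ ⟩
  fromℕ 6 * β₁ * sixth     ≡⟨ cong (_* sixth) six-β₁ ⟨
  (β₀ + β₂) * sixth        ≡⟨ *-distribʳ-+ sixth β₀ β₂ ⟩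
  β₀ * sixth + β₂ * sixth  ∎
  where
  open ≡-Reasoning
  β₀ β₁ β₂ : ℚ
  β₀ = fromℕ (B t)
  β₁ = fromℕ (B (suc t))
  β₂ = fromℕ (B (suc (suc t)))
  six-β₁ : β₀ + β₂ ≡ fromℕ 6 * β₁
  six-β₁ = trans (sym (fromℕ-homo-+ (B t) (B (suc (suc t)))))
                 (trans (cong fromℕ (B-rec t)) (fromℕ-homo-* 6 (B (suc t))))

fromℕ-five-B-suc : ∀ p →
  fromℕ 5 * fromℕ (B (suc p)) ≡ fromℕ (B p) + 1ℚ + fromℕ 2 * fromℕ (b (suc (suc p)))
fromℕ-five-B-suc p = begin
  fromℕ 5 * fromℕ (B (suc p))                        ≡⟨ fromℕ-homo-* 5 (B (suc p)) ⟨
  fromℕ (5 ℕ.* B (suc p))                            ≡⟨ cong fromℕ (five-B-suc p) ⟩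
  fromℕ (B p ℕ.+ 1 ℕ.+ 2 ℕ.* b (suc (suc p)))         ≡⟨ fromℕ-homo-+ (B p ℕ.+ 1) (2 ℕ.* b (suc (suc p))) ⟩
  fromℕ (B p ℕ.+ 1) + fromℕ (2 ℕ.* b (suc (suc p)))   ≡⟨ cong₂ _+_ (fromℕ-homo-+ (B p) 1)
                                                               (fromℕ-homo-* 2 (b (suc (suc p)))) ⟩
  fromℕ (B p) + 1ℚ + fromℕ 2 * fromℕ (b (suc (suc p))) ∎
  where open ≡-Reasoning

Bᴿ-recurrence : ∀ n → BalancingRecurrence n (Bᴿ n)
Bᴿ-recurrence n j 2+j≤n = begin
  fromℕ (B (n ∸ suc j))                                  ≡⟨ cong (fromℕ ∘ B) n∸[1+j] ⟩
  fromℕ (B (suc t))                                      ≡⟨ fromℕ-B-rec t ⟩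
  fromℕ (B t) * sixth + fromℕ (B (suc (suc t))) * sixth  ≡⟨ cong (λ s → fromℕ (B t) * sixth + fromℕ (B s) * sixth) n∸j ⟨
  Bᴿ n (suc (suc j)) * sixth + Bᴿ n j * sixth            ∎
  where
  open ≡-Reasoning
  t : ℕ
  t = n ∸ suc (suc j)
  n∸[1+j] : n ∸ suc j ≡ suc t
  n∸[1+j] = ℕₚ.+-∸-assoc 1 2+j≤n
  n∸j : n ∸ j ≡ suc (suc t)
  n∸j = trans (ℕₚ.+-∸-assoc 1 (ℕₚ.<⇒≤ 2+j≤n)) (cong suc n∸[1+j])

recurrence-unique : ∀ n (y : ℕ → ℚ) → y n ≡ 0ℚ → BalancingRecurrence n y →
  ∀ k → k ≤ n → y k ≡ y (pred n) * Bᴿ n k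
recurrence-unique n y yn≡0 rec k k≤n = proj₁ (from-top (n ∸ k)) k (ℕₚ.m+[n∸m]≡n k≤n)
  where
  c : ℚ
  c = y (pred n)

  from-top : ∀ t → (∀ k → k ℕ.+ t ≡ n → y k ≡ c * fromℕ (B t))
                 × (∀ k → k ℕ.+ suc t ≡ n → y k ≡ c * fromℕ (B (suc t)))
  from-top zero = at-top , below-top
    where
    at-top : ∀ k → k ℕ.+ 0 ≡ n → y k ≡ c * 0ℚ
    at-top k eq = trans (cong y (trans (sym (ℕₚ.+-identityʳ k)) eq)) (trans yn≡0 (sym (*-zeroʳ c)))
    below-top : ∀ k → k ℕ.+ 1 ≡ n → y k ≡ c * 1ℚ
    below-top k eq = trans (cong (y ∘ pred) (trans (ℕₚ.+-comm 1 k) eq)) (sym (*-identityʳ c))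
  from-top (suc t) = proj₂ (from-top t) , step
    where
    step : ∀ k → k ℕ.+ suc (suc t) ≡ n → y k ≡ c * fromℕ (B (suc (suc t)))
    step k eq = begin
      y k                                     ≡⟨ solve-last (y (suc (suc k))) (y k) (rec k 2+k≤n) ⟩
      fromℕ 6 * y (suc k) - y (suc (suc k))   ≡⟨ cong₂ (λ u v → fromℕ 6 * u - v)
                                                       (proj₂ (from-top t) (suc k) eq₁)
                                                       (proj₁ (from-top t) (suc (suc k)) eq₂) ⟩
      fromℕ 6 * (c * β₁) - c * β₀              ≡⟨ solve 3 (λ c u v → con (fromℕ 6) :* (c :* u) :- c :* v
                                                                := c :* (con (fromℕ 6) :* u :- v)) refl c β₁ β₀ ⟩
      c * (fromℕ 6 * β₁ - β₀)                  ≡⟨ cong (c *_) (solve-last β₀ β₂ (fromℕ-B-rec t)) ⟨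
      c * β₂                                  ∎
      where
      open ≡-Reasoning
      β₀ β₁ β₂ : ℚ
      β₀ = fromℕ (B t)
      β₁ = fromℕ (B (suc t))
      β₂ = fromℕ (B (suc (suc t)))
      eq₁ : suc k ℕ.+ suc t ≡ n
      eq₁ = trans (sym (ℕₚ.+-suc k (suc t))) eq
      eq₂ : suc (suc k) ℕ.+ t ≡ n
      eq₂ = trans (cong suc (sym (ℕₚ.+-suc k t))) eq₁
      2+k≤n : suc (suc k) ≤ n
      2+k≤n = subst (suc (suc k) ≤_) eq₂ (ℕₚ.m≤m+n (suc (suc k)) t)

fromℕ2*∑Bᴿ : ∀ n → fromℕ 2 * ∑[ i < n ] Bᴿ n (toℕ i) ≡ fromℕ (b (suc n))
fromℕ2*∑Bᴿ zero    = refl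
fromℕ2*∑Bᴿ (suc n) = begin
  fromℕ 2 * (fromℕ (B (suc n)) + ∑[ i < n ] Bᴿ n (toℕ i))
    ≡⟨ *-distribˡ-+ (fromℕ 2) (fromℕ (B (suc n))) _ ⟩
  fromℕ 2 * fromℕ (B (suc n)) + fromℕ 2 * ∑[ i < n ] Bᴿ n (toℕ i)
    ≡⟨ cong₂ _+_ (sym (fromℕ-homo-* 2 (B (suc n)))) (fromℕ2*∑Bᴿ n) ⟩
  fromℕ (2 ℕ.* B (suc n)) + fromℕ (b (suc n))
    ≡⟨ fromℕ-homo-+ (2 ℕ.* B (suc n)) (b (suc n)) ⟨
  fromℕ (2 ℕ.* B (suc n) ℕ.+ b (suc n))
    ≡⟨ cong fromℕ (trans (ℕₚ.+-comm (2 ℕ.* B (suc n)) (b (suc n))) (sym (b-suc (suc n)))) ⟩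
  fromℕ (b (suc (suc n))) ∎
  where open ≡-Reasoning

zeroExtend : ∀ {n} → (Fin n → ℚ) → ℕ → ℚ
zeroExtend {zero}  π k       = 0ℚ
zeroExtend {suc n} π zero    = π fz
zeroExtend {suc n} π (suc k) = zeroExtend (π ∘ fs) k

zeroExtend-toℕ : ∀ {n} (π : Fin n → ℚ) i → zeroExtend π (toℕ i) ≡ π i
zeroExtend-toℕ π fz     = refl
zeroExtend-toℕ π (fs i) = zeroExtend-toℕ (π ∘ fs) i

zeroExtend-vanishes : ∀ {n} (π : Fin n → ℚ) → VanishesFrom n (zeroExtend π)
zeroExtend-vanishes {zero}  π k       _         = refl
zeroExtend-vanishes {suc n} π (suc k) (s≤s n≤k) = zeroExtend-vanishes (π ∘ fs) k n≤k

Σ-timesP : ∀ n (π : Fin n → ℚ) (x : ℕ → ℚ) → (∀ i → π i ≡ x (toℕ i)) →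
  ∀ j → Σ n (λ i → π i * P n i j) ≡ timesP n x (toℕ j)
Σ-timesP n π x π≡x j = trans (Σ≡sum n _) (sum-cong-≗ (λ i → cong (_* P n i j) (π≡x i)))

private
  inverse-unique : ∀ {a c s} → a * s ≡ 1ℚ → c * s ≡ 1ℚ → a ≡ c
  inverse-unique {a} {c} {s} as≡1 cs≡1 = begin
    a            ≡⟨ *-identityʳ a ⟨
    a * 1ℚ       ≡⟨ cong (a *_) cs≡1 ⟨
    a * (c * s)  ≡⟨ solve 3 (λ a c s → a :* (c :* s) := c :* (a :* s)) refl a c s ⟩
    c * (a * s)  ≡⟨ cong (c *_) as≡1 ⟩
    c * 1ℚ       ≡⟨ *-identityʳ c ⟩
    c            ∎
    where open ≡-Reasoning

  -- The column-0 equation for π k = c B (n-k), with X = B n, Y = B (n-1), E = b (n+1).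
  column-zero-identity : ∀ c X Y E → fromℕ 5 * X ≡ Y + 1ℚ + fromℕ 2 * E → c * E ≡ fromℕ 2 →
    c * X ≡ ℤ.+ 2 / 3 * 1ℚ + (c * X * sixth + c * Y * sixth + c * 1ℚ * sixth)
  column-zero-identity c X Y E five-X cE≡2 = begin
    c * X
      ≡⟨ cX≡Z ⟩
    Z
      ≡⟨ solve 2 (λ cY c → con (ℤ.+ 1 / 5) :* (cY :+ c :+ con (fromℕ 4))
                := con (ℤ.+ 2 / 3) :* con 1ℚ
                   :+ (con (ℤ.+ 1 / 5) :* (cY :+ c :+ con (fromℕ 4)) :* con sixth
                       :+ cY :* con sixth :+ c :* con 1ℚ :* con sixth)) refl (c * Y) c ⟩
    ℤ.+ 2 / 3 * 1ℚ + (Z * sixth + c * Y * sixth + c * 1ℚ * sixth)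
      ≡⟨ cong (λ z → ℤ.+ 2 / 3 * 1ℚ + (z * sixth + c * Y * sixth + c * 1ℚ * sixth)) cX≡Z ⟨
    ℤ.+ 2 / 3 * 1ℚ + (c * X * sixth + c * Y * sixth + c * 1ℚ * sixth) ∎
    where
    open ≡-Reasoning
    Z : ℚ
    Z = ℤ.+ 1 / 5 * (c * Y + c + fromℕ 4)
    cX≡Z : c * X ≡ Z
    cX≡Z = begin
      c * X
        ≡⟨ solve 2 (λ c X → c :* X := con (ℤ.+ 1 / 5) :* (c :* (con (fromℕ 5) :* X))) refl c X ⟩
      ℤ.+ 1 / 5 * (c * (fromℕ 5 * X))
        ≡⟨ cong (λ t → ℤ.+ 1 / 5 * (c * t)) five-X ⟩
      ℤ.+ 1 / 5 * (c * (Y + 1ℚ + fromℕ 2 * E))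
        ≡⟨ solve 3 (λ c Y E → con (ℤ.+ 1 / 5) :* (c :* (Y :+ con 1ℚ :+ con (fromℕ 2) :* E))
                           := con (ℤ.+ 1 / 5) :* (c :* Y :+ c :+ con (fromℕ 2) :* (c :* E))) refl c Y E ⟩
      ℤ.+ 1 / 5 * (c * Y + c + fromℕ 2 * (c * E))
        ≡⟨ cong (λ t → ℤ.+ 1 / 5 * (c * Y + c + fromℕ 2 * t)) cE≡2 ⟩
      Z ∎

module _ (m : ℕ) where
  private
    N D : ℕ
    N = 3 ℕ.+ m
    D = b (suc N)

    c⋆ : ℚ
    c⋆ = fromℕ 2 * frac 1 D

    S : ℚ
    S = ∑[ i < N ] Bᴿ N (toℕ i)

    D*frac1D : fromℕ D * frac 1 D ≡ 1ℚ
    D*frac1D = fromℕ*frac1 (b-pos (suc (suc m)))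

    c⋆*D : c⋆ * fromℕ D ≡ fromℕ 2
    c⋆*D = begin
      fromℕ 2 * frac 1 D * fromℕ D    ≡⟨ solve 3 (λ a r e → a :* r :* e := a :* (e :* r)) refl
                                                 (fromℕ 2) (frac 1 D) (fromℕ D) ⟩
      fromℕ 2 * (fromℕ D * frac 1 D)  ≡⟨ cong (fromℕ 2 *_) D*frac1D ⟩
      fromℕ 2 * 1ℚ                    ≡⟨ *-identityʳ (fromℕ 2) ⟩
      fromℕ 2                         ∎
      where open ≡-Reasoning

    c⋆*S : c⋆ * S ≡ 1ℚ
    c⋆*S = begin
      fromℕ 2 * frac 1 D * S  ≡⟨ solve 3 (λ a r s → a :* r :* s := a :* s :* r) refl (fromℕ 2) (frac 1 D) S ⟩
      fromℕ 2 * S * frac 1 D  ≡⟨ cong (_* frac 1 D) (fromℕ2*∑Bᴿ N) ⟩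
      fromℕ D * frac 1 D      ≡⟨ D*frac1D ⟩
      1ℚ                      ∎
      where open ≡-Reasoning

    candidate : ℕ → ℚ
    candidate k = c⋆ * Bᴿ N k

    πexp≡candidate : ∀ i → πexp N i ≡ candidate (toℕ i)
    πexp≡candidate i = begin
      frac (2 ℕ.* B (N ∸ toℕ i)) D            ≡⟨ frac-fromℕ (2 ℕ.* B (N ∸ toℕ i)) D ⟩
      fromℕ (2 ℕ.* B (N ∸ toℕ i)) * frac 1 D  ≡⟨ cong (_* frac 1 D) (fromℕ-homo-* 2 (B (N ∸ toℕ i))) ⟩
      fromℕ 2 * β * frac 1 D                  ≡⟨ solve 3 (λ a u r → a :* u :* r := a :* r :* u) refl
                                                         (fromℕ 2) β (frac 1 D) ⟩
      c⋆ * β                                  ∎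
      where
      open ≡-Reasoning
      β : ℚ
      β = Bᴿ N (toℕ i)

    candidate-sum : ∑[ i < N ] candidate (toℕ i) ≡ 1ℚ
    candidate-sum = trans (sym (*-distribˡ-sum {N} c⋆ (λ i → Bᴿ N (toℕ i)))) c⋆*S

    candidate-vanishes : VanishesFrom N candidate
    candidate-vanishes k N≤k =
      trans (cong (λ t → c⋆ * fromℕ (B t)) (ℕₚ.m≤n⇒m∸n≡0 N≤k)) (*-zeroʳ c⋆)

    candidate-stationary : ∀ k → k < N → candidate k ≡ timesP N candidate k
    candidate-stationary zero _ = begin
      c⋆ * fromℕ (B N)
        ≡⟨ column-zero-identity c⋆ (fromℕ (B N)) (fromℕ (B (suc (suc m)))) (fromℕ D)
                                (fromℕ-five-B-suc (suc (suc m))) c⋆*D ⟩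
      ℤ.+ 2 / 3 * 1ℚ + (candidate 0 * sixth + candidate 1 * sixth + c⋆ * 1ℚ * sixth)
        ≡⟨ cong₂ (λ s t → ℤ.+ 2 / 3 * s + (candidate 0 * sixth + candidate 1 * sixth
                                          + c⋆ * fromℕ (B t) * sixth))
                 candidate-sum (ℕₚ.m+n∸n≡m 1 m) ⟨
      ℤ.+ 2 / 3 * ∑[ i < N ] candidate (toℕ i)
        + (candidate 0 * sixth + candidate 1 * sixth + candidate (suc (suc m)) * sixth)
        ≡⟨ timesP-zero m candidate candidate-vanishes ⟨
      timesP N candidate 0 ∎
      where open ≡-Reasoning
    candidate-stationary (suc j) 1+j<N = begin
      candidate (suc j)
        ≡⟨ cong (c⋆ *_) (Bᴿ-recurrence N j 1+j<N) ⟩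
      c⋆ * (Bᴿ N (suc (suc j)) * sixth + Bᴿ N j * sixth)
        ≡⟨ solve 3 (λ c u v → c :* (u :* con sixth :+ v :* con sixth)
                           := c :* u :* con sixth :+ c :* v :* con sixth) refl c⋆ (Bᴿ N (suc (suc j))) (Bᴿ N j) ⟩
      candidate (suc (suc j)) * sixth + candidate j * sixth
        ≡⟨ timesP-suc m candidate candidate-vanishes j (ℕ.s≤s⁻¹ (ℕ.s≤s⁻¹ 1+j<N)) ⟨
      timesP N candidate (suc j) ∎
      where open ≡-Reasoning

  πexp-steady : IsSteadyState N (P N) (πexp N)
  πexp-steady = (λ i → frac-nonNegative _ D) , sum-one , column
    where
    sum-one : Σ N (πexp N) ≡ 1ℚ
    sum-one = trans (Σ≡sum N (πexp N)) (trans (sum-cong-≗ πexp≡candidate) candidate-sum)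
    column : ∀ j → πexp N j ≡ Σ N (λ i → πexp N i * P N i j)
    column j = trans (πexp≡candidate j)
      (trans (candidate-stationary (toℕ j) (Finₚ.toℕ<n j))
             (sym (Σ-timesP N (πexp N) candidate πexp≡candidate j)))

  stationary⇒recurrence : (π : Fin N → ℚ) → (∀ j → π j ≡ Σ N (λ i → π i * P N i j)) →
    BalancingRecurrence N (zeroExtend π)
  stationary⇒recurrence π column j 1+j<N = begin
    y (suc j)                              ≡⟨ cong y (Finₚ.toℕ-fromℕ< 1+j<N) ⟨
    y (toℕ f)                              ≡⟨ zeroExtend-toℕ π f ⟩
    π f                                    ≡⟨ column f ⟩
    Σ N (λ i → π i * P N i f)              ≡⟨ Σ-timesP N π y (sym ∘ zeroExtend-toℕ π) f ⟩
    timesP N y (toℕ f)                     ≡⟨ cong (timesP N y) (Finₚ.toℕ-fromℕ< 1+j<N) ⟩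
    timesP N y (suc j)                     ≡⟨ timesP-suc m y (zeroExtend-vanishes π) j (ℕ.s≤s⁻¹ (ℕ.s≤s⁻¹ 1+j<N)) ⟩
    y (suc (suc j)) * sixth + y j * sixth  ∎
    where
    open ≡-Reasoning
    y : ℕ → ℚ
    y = zeroExtend π
    f : Fin N
    f = fromℕ< 1+j<N

  steady-unique : ∀ π → IsSteadyState N (P N) π → ∀ i → π i ≡ πexp N i
  steady-unique π (_ , sum-π , column-π) i = begin
    π i                ≡⟨ π≡cBᴿ i ⟩
    c * Bᴿ N (toℕ i)   ≡⟨ cong (_* Bᴿ N (toℕ i)) (inverse-unique {c} {c⋆} {S} c*S c⋆*S) ⟩
    candidate (toℕ i)  ≡⟨ πexp≡candidate i ⟨
    πexp N i           ∎
    where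
    open ≡-Reasoning
    c : ℚ
    c = zeroExtend π (suc (suc m))

    π≡cBᴿ : ∀ i → π i ≡ c * Bᴿ N (toℕ i)
    π≡cBᴿ i = trans (sym (zeroExtend-toℕ π i))
      (recurrence-unique N (zeroExtend π) (zeroExtend-vanishes π N ℕₚ.≤-refl)
                         (stationary⇒recurrence π column-π) (toℕ i) (ℕₚ.<⇒≤ (Finₚ.toℕ<n i)))

    c*S : c * S ≡ 1ℚ
    c*S = begin
      c * S                          ≡⟨ *-distribˡ-sum {N} c (λ i → Bᴿ N (toℕ i)) ⟩
      ∑[ i < N ] (c * Bᴿ N (toℕ i))  ≡⟨ sum-cong-≗ π≡cBᴿ ⟨
      ∑[ i < N ] π i                 ≡⟨ Σ≡sum N π ⟨
      Σ N π                          ≡⟨ sum-π ⟩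
      1ℚ                             ∎

theorem2p1 : (n : ℕ) → 3 ≤ n →
    IsSteadyState n (P n) (πexp n) ×
    ((π : Fin n → ℚ) → IsSteadyState n (P n) π → ∀ i → π i ≡ πexp n i)
theorem2p1 (suc (suc (suc m))) (s≤s (s≤s (s≤s z≤n))) = πexp-steady m , steady-unique m
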